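{- Let $n\ge 6$ and $\pi=(d_1,3^5,2^{n-6})$ with $5\le d_1\le n-1$ and $\sigma(\pi)$ even. Then (1) $\pi$ is graphic; and (2) $\pi$ is potentially $K_6-C_5$-graphic if and only if $\pi\ne(5,3^5,2)$ and $\pi\ne(5,3^5,2^2)$.
   Context: A non-increasing sequence of nonnegative integers is graphic if it is the degree sequence of a simple graph; it is potentially $H$-graphic if some such graph contains $H$ as a subgraph. $\sigma(\pi)$ is the sum of the terms of $\pi$. $r^t$ denotes $t$ terms equal to $r$. $K_6-C_5$ denotes $K_6$ with the edges of a 5-cycle on five of its vertices removed. -}

module Defs where

open import Data.Bool using (Bool; true; false; if_then_else_)
open import Data.Nat using (ℕ; _∸_)
open import Data.Nat.ListAction using (sum)
open import Data.Fin using (Fin)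
open import Data.Fin.Patterns
open import Data.List using (List; _∷_; []; length; map; allFin; lookup; replicate; _++_)
open import Data.Product using (Σ; ∃; _×_)
open import Function.Definitions using (Injective)
open import Relation.Binary.PropositionalEquality using (_≡_; refl)

record Graph (n : ℕ) : Set where
  field
    adj    : Fin n → Fin n → Bool
    sym    : ∀ i j → adj i j ≡ adj j i
    irrefl : ∀ i → adj i i ≡ false
open Graph public

deg : ∀ {n} → Graph n → Fin n → ℕ
deg {n} G i = sum (map (λ j → if adj G i j then 1 else 0) (allFin n))

Realizes : (π : List ℕ) → Graph (length π) → Set
Realizes π G = ∀ i → deg G i ≡ lookup π i

Graphic : List ℕ → Set
Graphic π = Σ (Graph (length π)) (Realizes π)

SubgraphOf : ∀ {k n} → Graph k → Graph n → Set
SubgraphOf {k} {n} H G =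
  Σ (Fin k → Fin n) λ f → Injective _≡_ _≡_ f ×
    (∀ i j → adj H i j ≡ true → adj G (f i) (f j) ≡ true)

PotentiallyGraphic : ∀ {k} → Graph k → List ℕ → Set
PotentiallyGraphic H π = Σ (Graph (length π)) λ G → Realizes π G × SubgraphOf H G

-- K6 - C5: K6 on vertices 0..5 with the edges of the 5-cycle 0-1-2-3-4-0 removed
k6c5adj : Fin 6 → Fin 6 → Bool
k6c5adj 0F 0F = false
k6c5adj 0F 1F = false
k6c5adj 0F 2F = true
k6c5adj 0F 3F = true
k6c5adj 0F 4F = false
k6c5adj 0F 5F = true
k6c5adj 1F 0F = false
k6c5adj 1F 1F = false
k6c5adj 1F 2F = false
k6c5adj 1F 3F = true
k6c5adj 1F 4F = true
k6c5adj 1F 5F = true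
k6c5adj 2F 0F = true
k6c5adj 2F 1F = false
k6c5adj 2F 2F = false
k6c5adj 2F 3F = false
k6c5adj 2F 4F = true
k6c5adj 2F 5F = true
k6c5adj 3F 0F = true
k6c5adj 3F 1F = true
k6c5adj 3F 2F = false
k6c5adj 3F 3F = false
k6c5adj 3F 4F = false
k6c5adj 3F 5F = true
k6c5adj 4F 0F = false
k6c5adj 4F 1F = true
k6c5adj 4F 2F = true
k6c5adj 4F 3F = false
k6c5adj 4F 4F = false
k6c5adj 4F 5F = true
k6c5adj 5F 0F = true
k6c5adj 5F 1F = true
k6c5adj 5F 2F = true
k6c5adj 5F 3F = true
k6c5adj 5F 4F = true
k6c5adj 5F 5F = false

k6c5sym : ∀ i j → k6c5adj i j ≡ k6c5adj j i
k6c5sym 0F 0F = refl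
k6c5sym 0F 1F = refl
k6c5sym 0F 2F = refl
k6c5sym 0F 3F = refl
k6c5sym 0F 4F = refl
k6c5sym 0F 5F = refl
k6c5sym 1F 0F = refl
k6c5sym 1F 1F = refl
k6c5sym 1F 2F = refl
k6c5sym 1F 3F = refl
k6c5sym 1F 4F = refl
k6c5sym 1F 5F = refl
k6c5sym 2F 0F = refl
k6c5sym 2F 1F = refl
k6c5sym 2F 2F = refl
k6c5sym 2F 3F = refl
k6c5sym 2F 4F = refl
k6c5sym 2F 5F = refl
k6c5sym 3F 0F = refl
k6c5sym 3F 1F = refl
k6c5sym 3F 2F = refl
k6c5sym 3F 3F = refl
k6c5sym 3F 4F = refl
k6c5sym 3F 5F = refl
k6c5sym 4F 0F = refl
k6c5sym 4F 1F = refl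
k6c5sym 4F 2F = refl
k6c5sym 4F 3F = refl
k6c5sym 4F 4F = refl
k6c5sym 4F 5F = refl
k6c5sym 5F 0F = refl
k6c5sym 5F 1F = refl
k6c5sym 5F 2F = refl
k6c5sym 5F 3F = refl
k6c5sym 5F 4F = refl
k6c5sym 5F 5F = refl

k6c5irrefl : ∀ i → k6c5adj i i ≡ false
k6c5irrefl 0F = refl
k6c5irrefl 1F = refl
k6c5irrefl 2F = refl
k6c5irrefl 3F = refl
k6c5irrefl 4F = refl
k6c5irrefl 5F = refl

K6-C5 : Graph 6
K6-C5 = record { adj = k6c5adj ; sym = k6c5sym ; irrefl = k6c5irrefl }

piSeq : ℕ → ℕ → List ℕ
piSeq n d₁ = d₁ ∷ (replicate 5 3 ++ replicate (n ∸ 6) 2)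

module Submission where

open import Defs
open import Data.Nat using (ℕ; _≤_; _∸_)
open import Data.Nat.Divisibility using (_∣_)
open import Data.List using (List; _∷_; [])
open import Data.Nat.ListAction using (sum)
open import Data.Product using (_×_)
open import Function.Bundles using (_⇔_)
open import Relation.Binary.PropositionalEquality using (_≢_)

open import Data.Bool using (Bool; true; false; if_then_else_; _∨_; _∧_)
import Data.Bool.Properties as Bool
open import Data.Empty using (⊥-elim)
open import Data.Fin using (Fin; zero; suc; toℕ; punchIn; punchOut; opposite; _↑ˡ_)
open import Data.Fin.Patterns using (0F; 1F; 2F; 3F; 4F; 5F; 6F; 7F)
import Data.Fin.Properties as Fin
open import Data.List using (tabulate; map; lookup; length; replicate)
open import Data.List.Properties using (map-tabulate; length-replicate)
open import Data.Nat using (zero; suc; _+_; _*_; _<_; z≤n; s≤s; _≡ᵇ_; _<ᵇ_; _≤?_)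
  renaming (_≟_ to _≟ℕ_)
open import Data.Nat.Divisibility using (divides; ∣m+n∣m⇒∣n; n∣m*n)
open import Data.Nat.Properties hiding (_≟_)
open import Algebra.Properties.CommutativeMonoid.Sum +-0-commutativeMonoid
  using (sum-syntax; sum-remove; sum-cong-≗; sum-replicate-zero)
open import Algebra.Properties.CommutativeSemigroup +-commutativeSemigroup using (xy∙z≈y∙xz)
open import Data.Nat.Tactic.RingSolver using (solve-∀)
open import Data.Product using (∃; _,_; proj₁)
open import Data.Sum using (_⊎_; inj₁; inj₂; [_,_])
import Data.Vec.Functional as Vector
open import Function using (_∘_; id)
open import Function.Bundles using (mk⇔)
open import Function.Definitions using (Injective)
open import Relation.Binary.PropositionalEquality as ≡ using (_≡_; refl; cong; module ≡-Reasoning)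
open import Relation.Nullary using (yes; no; ¬_)
open import Relation.Nullary.Decidable using (_→-dec_; toWitness)

-- Write π = (5 + e, 3⁵, 2ᵐ); evenness of σ(π) makes e even.  In a realisation containing
-- K6 − C5 the centre of K6 − C5 must sit on the vertex of degree 5 + e and the other five
-- vertices on the 3's, which are then saturated.  So such a realisation is K6 − C5 plus a
-- "tail" on the m vertices of degree 2: a graph of maximum degree 2 in which exactly e
-- vertices have degree 1 and are joined to the centre.  Tails are built from triangles
-- through the centre by subdividing, and for e = 0 from a cycle; they exist unless e = 0
-- and m ∈ {1, 2}, since a cycle needs three vertices.  In these two cases a degree count
-- excludes every embedding: the image of K6 − C5 takes at least 20 of the 20 + 2m degree
-- units, and a vertex of degree 2 still has an edge that either raises a degree in the
-- image or reaches a further vertex outside it.  Both sequences are graphic nevertheless: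
-- join vertex 0 to 1, …, 5 and run a cycle through all vertices but 0.

indicator : Bool → ℕ
indicator b = if b then 1 else 0

∑-mono-≤ : ∀ {n} {g h : Fin n → ℕ} → (∀ i → g i ≤ h i) → ∑[ i < n ] g i ≤ ∑[ i < n ] h i
∑-mono-≤ {zero}  _   = z≤n
∑-mono-≤ {suc n} g≤h = +-mono-≤ (g≤h zero) (∑-mono-≤ (g≤h ∘ suc))

∑-mono-< : ∀ {n} {g h : Fin n → ℕ} → (∀ i → g i ≤ h i) → ∀ i → g i < h i →
           ∑[ i < n ] g i < ∑[ i < n ] h i
∑-mono-< g≤h zero    g<h = +-mono-<-≤ g<h (∑-mono-≤ (g≤h ∘ suc))
∑-mono-< g≤h (suc i) g<h = +-mono-≤-< (g≤h zero) (∑-mono-< (g≤h ∘ suc) i g<h)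

term≤∑ : ∀ {n} (g : Fin n → ℕ) i → g i ≤ ∑[ j < n ] g j
term≤∑ {suc n} g i = ≤-trans (m≤m+n (g i) _) (≤-reflexive (≡.sym (sum-remove {i = i} g)))

∑-injective-≤ : ∀ {k n} (F : Fin k → Fin n) → Injective _≡_ _≡_ F → (g : Fin n → ℕ) →
                ∑[ i < k ] g (F i) ≤ ∑[ j < n ] g j
∑-injective-≤ {zero}          F F-inj g = z≤n
∑-injective-≤ {suc k} {zero}  F F-inj g with F zero
... | ()
∑-injective-≤ {suc k} {suc n} F F-inj g = begin
  g (F zero) + ∑[ i < k ] g (F (suc i))                ≡⟨ cong (g (F zero) +_) (sum-cong-≗ F∘suc≗) ⟩
  g (F zero) + ∑[ i < k ] g (punchIn (F zero) (F′ i))  ≤⟨ +-monoʳ-≤ (g (F zero)) (∑-injective-≤ F′ F′-inj _) ⟩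
  g (F zero) + ∑[ j < n ] g (punchIn (F zero) j)       ≡⟨ sum-remove g ⟨
  ∑[ j < suc n ] g j                                   ∎
  where
  open ≤-Reasoning
  F₀≢ : ∀ i → F zero ≢ F (suc i)
  F₀≢ i eq with F-inj eq
  ... | ()
  F′ : Fin k → Fin n
  F′ i = punchOut (F₀≢ i)
  F′-inj : Injective _≡_ _≡_ F′
  F′-inj {i} {j} eq = Fin.suc-injective (F-inj (Fin.punchOut-injective (F₀≢ i) (F₀≢ j) eq))
  F∘suc≗ : ∀ i → g (F (suc i)) ≡ g (punchIn (F zero) (F′ i))
  F∘suc≗ i = cong g (≡.sym (Fin.punchIn-punchOut (F₀≢ i)))

∷-injective : ∀ {k n} {F : Fin k → Fin n} {w} → Injective _≡_ _≡_ F → (∀ i → F i ≢ w) →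
              Injective _≡_ _≡_ (w Vector.∷ F)
∷-injective F-inj w∉F {zero}  {zero}  _  = refl
∷-injective F-inj w∉F {zero}  {suc j} eq = ⊥-elim (w∉F j (≡.sym eq))
∷-injective F-inj w∉F {suc i} {zero}  eq = ⊥-elim (w∉F i eq)
∷-injective F-inj w∉F {suc i} {suc j} eq = cong suc (F-inj eq)

∑-disjoint-≤ : ∀ {p q n} (F : Fin p → Fin n) (F′ : Fin q → Fin n) →
               Injective _≡_ _≡_ F → Injective _≡_ _≡_ F′ → (∀ a b → F a ≢ F′ b) → (g : Fin n → ℕ) →
               ∑[ a < p ] g (F a) + ∑[ b < q ] g (F′ b) ≤ ∑[ j < n ] g j
∑-disjoint-≤ {zero}  F F′ F-inj F′-inj F∩F′ g = ∑-injective-≤ F′ F′-inj g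
∑-disjoint-≤ {suc p} F F′ F-inj F′-inj F∩F′ g = begin
  g (F zero) + ∑[ a < p ] g (F (suc a)) + ∑[ b < _ ] g (F′ b)       ≡⟨ xy∙z≈y∙xz (g (F zero)) _ _ ⟩
  ∑[ a < p ] g (F (suc a)) + ∑[ b < _ ] g ((F zero Vector.∷ F′) b) ≤⟨ ∑-disjoint-≤ (F ∘ suc) _ F∘suc-inj ∷-inj F∘suc∩∷ g ⟩
  ∑[ j < _ ] g j                                                    ∎
  where
  open ≤-Reasoning
  F∘suc-inj : Injective _≡_ _≡_ (F ∘ suc)
  F∘suc-inj = Fin.suc-injective ∘ F-inj
  ∷-inj : Injective _≡_ _≡_ (F zero Vector.∷ F′)
  ∷-inj = ∷-injective F′-inj (λ b → F∩F′ zero b ∘ ≡.sym)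
  F∘suc∩∷ : ∀ a b → F (suc a) ≢ (F zero Vector.∷ F′) b
  F∘suc∩∷ a zero    eq with F-inj eq
  ... | ()
  F∘suc∩∷ a (suc b) = F∩F′ (suc a) b

sum-tabulate : ∀ {n} (h : Fin n → ℕ) → sum (tabulate h) ≡ ∑[ j < n ] h j
sum-tabulate {zero}  h = refl
sum-tabulate {suc n} h = cong (h zero +_) (sum-tabulate (h ∘ suc))

deg≡∑adj : ∀ {n} (G : Graph n) i → deg G i ≡ ∑[ j < n ] indicator (adj G i j)
deg≡∑adj {n} G i = ≡.trans (cong sum (map-tabulate {n = n} id (indicator ∘ adj G i)))
                           (sum-tabulate (indicator ∘ adj G i))

indicator-mono : ∀ {a b} → (a ≡ true → b ≡ true) → indicator a ≤ indicator b
indicator-mono {false} a⇒b = z≤n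
indicator-mono {true}  a⇒b rewrite a⇒b refl = ≤-refl

adj⇒0<deg : ∀ {n} (G : Graph n) {v w} → adj G v w ≡ true → 0 < deg G v
adj⇒0<deg {n} G {v} {w} v~w = begin
  1                                  ≡⟨ cong indicator v~w ⟨
  indicator (adj G v w)              ≤⟨ term≤∑ (indicator ∘ adj G v) w ⟩
  ∑[ j < n ] indicator (adj G v j)   ≡⟨ deg≡∑adj G v ⟨
  deg G v                            ∎
  where open ≤-Reasoning

unique-neighbour⇒deg≤1 : ∀ {n} (G : Graph (suc n)) {v} u → (∀ w → adj G v w ≡ true → w ≡ u) →
                         deg G v ≤ 1
unique-neighbour⇒deg≤1 {n} G {v} u adj⇒≡u = begin
  deg G v                                                                ≡⟨ deg≡∑adj G v ⟩
  ∑[ j < suc n ] indicator (adj G v j)                                   ≡⟨ sum-remove (indicator ∘ adj G v) ⟩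
  indicator (adj G v u) + ∑[ j < n ] indicator (adj G v (punchIn u j))   ≡⟨ cong (indicator (adj G v u) +_) (sum-cong-≗ others) ⟩
  indicator (adj G v u) + ∑[ j < n ] 0                                   ≡⟨ cong (indicator (adj G v u) +_) (sum-replicate-zero n) ⟩
  indicator (adj G v u) + 0                                              ≡⟨ +-identityʳ _ ⟩
  indicator (adj G v u)                                                  ≤⟨ indicator≤1 (adj G v u) ⟩
  1                                                                      ∎
  where
  open ≤-Reasoning
  indicator≤1 : ∀ b → indicator b ≤ 1
  indicator≤1 false = z≤n
  indicator≤1 true  = ≤-refl
  others : ∀ j → indicator (adj G v (punchIn u j)) ≡ 0
  others j with adj G v (punchIn u j) in v~j
  ... | false = refl
  ... | true  = ⊥-elim (Fin.punchInᵢ≢i u j (adj⇒≡u _ v~j))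

neighbour-other-than : ∀ {n} (G : Graph n) {v} → 2 ≤ deg G v → ∀ u → ∃ λ w → w ≢ u × adj G v w ≡ true
neighbour-other-than {suc n} G {v} 2≤deg u
  with Fin.¬∀⟶∃¬ (suc n) (λ w → adj G v w ≡ true → w ≡ u)
         (λ w → (adj G v w Bool.≟ true) →-dec (w Fin.≟ u))
         (λ adj⇒≡u → <⇒≱ 2≤deg (unique-neighbour⇒deg≤1 G u adj⇒≡u))
... | w , ¬adj⇒≡u with adj G v w in v~w
...   | true  = w , (λ w≡u → ¬adj⇒≡u (λ _ → w≡u)) , v~w
...   | false = ⊥-elim (¬adj⇒≡u (λ ()))

symmetricClosure : ∀ n (R : ℕ → ℕ → Bool) → (∀ (i : Fin n) → R (toℕ i) (toℕ i) ≡ false) → Graph n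
symmetricClosure n R R-irrefl = record
  { adj    = λ i j → R (toℕ i) (toℕ j) ∨ R (toℕ j) (toℕ i)
  ; sym    = λ i j → Bool.∨-comm (R (toℕ i) (toℕ j)) _
  ; irrefl = λ i → ≡.cong₂ _∨_ (R-irrefl i) (R-irrefl i)
  }

module Embedding {k n} {H : Graph k} {G : Graph n} (f : Fin k → Fin n) (f-inj : Injective _≡_ _≡_ f)
                 (f-edge : ∀ i j → adj H i j ≡ true → adj G (f i) (f j) ≡ true) where

  deg≤∑adj-image : ∀ i → deg H i ≤ ∑[ b < k ] indicator (adj G (f i) (f b))
  deg≤∑adj-image i = ≤-trans (≤-reflexive (deg≡∑adj H i)) (∑-mono-≤ (indicator-mono ∘ f-edge i))

  deg≤deg-image : ∀ i → deg H i ≤ deg G (f i)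
  deg≤deg-image i = begin
    deg H i                                    ≤⟨ deg≤∑adj-image i ⟩
    ∑[ b < k ] indicator (adj G (f i) (f b))   ≤⟨ ∑-injective-≤ f f-inj (indicator ∘ adj G (f i)) ⟩
    ∑[ j < n ] indicator (adj G (f i) j)       ≡⟨ deg≡∑adj G (f i) ⟨
    deg G (f i)                                ∎
    where open ≤-Reasoning

  deg<deg-image : ∀ {i w} → (∀ b → f b ≢ w) → adj G (f i) w ≡ true → deg H i < deg G (f i)
  deg<deg-image {i} {w} w∉f fi~w = begin-strict
    deg H i                                                        <⟨ s≤s (deg≤∑adj-image i) ⟩
    1 + ∑[ b < k ] indicator (adj G (f i) (f b))                   ≡⟨ cong (λ x → indicator x + ∑adj-image) fi~w ⟨
    indicator (adj G (f i) w) + ∑adj-image                         ≤⟨ ∑-injective-≤ (w Vector.∷ f) (∷-injective f-inj w∉f) _ ⟩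
    ∑[ j < n ] indicator (adj G (f i) j)                           ≡⟨ deg≡∑adj G (f i) ⟨
    deg G (f i)                                                    ∎
    where
    open ≤-Reasoning
    ∑adj-image = ∑[ b < k ] indicator (adj G (f i) (f b))

  deg<⇒∉image : ∀ b {v} → deg G v < deg H b → f b ≢ v
  deg<⇒∉image b v<b refl = <⇒≱ v<b (deg≤deg-image b)

  -- If w is in the image, it raises the degree of its preimage above the degree in H;
  -- otherwise its own degree is counted on top of P and the image.
  ∑deg-outside+∑deg<∑deg : ∀ {p} (P : Fin p → Fin n) → Injective _≡_ _≡_ P → (∀ a b → P a ≢ f b) →
                           ∀ {l w} → adj G (P l) w ≡ true → (∀ a → P a ≢ w) →
                           ∑[ a < p ] deg G (P a) + ∑[ i < k ] deg H i < ∑[ j < n ] deg G j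
  ∑deg-outside+∑deg<∑deg {p} P P-inj P∩f {l} {w} Pl~w w∉P with Fin.any? (λ i → f i Fin.≟ w)
  ... | yes (i , refl) = begin-strict
    ∑[ a < p ] deg G (P a) + ∑[ i < k ] deg H i      <⟨ +-monoʳ-< _ (∑-mono-< deg≤deg-image i deg-fi) ⟩
    ∑[ a < p ] deg G (P a) + ∑[ i < k ] deg G (f i)  ≤⟨ ∑-disjoint-≤ P f P-inj f-inj P∩f (deg G) ⟩
    ∑[ j < n ] deg G j                               ∎
    where
    open ≤-Reasoning
    deg-fi : deg H i < deg G (f i)
    deg-fi = deg<deg-image (λ b → P∩f l b ∘ ≡.sym) (≡.trans (Graph.sym G (f i) (P l)) Pl~w)
  ... | no w∉f = begin-strict
    ∑[ a < p ] deg G (P a) + ∑[ i < k ] deg H i                 <⟨ n<1+n _ ⟩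
    suc (∑[ a < p ] deg G (P a)) + ∑[ i < k ] deg H i           ≤⟨ +-mono-≤ (+-monoˡ-≤ _ deg-w) (∑-mono-≤ deg≤deg-image) ⟩
    deg G w + ∑[ a < p ] deg G (P a) + ∑[ i < k ] deg G (f i)   ≤⟨ ∑-disjoint-≤ (w Vector.∷ P) f w∷P-inj f-inj w∷P∩f (deg G) ⟩
    ∑[ j < n ] deg G j                                          ∎
    where
    open ≤-Reasoning
    deg-w : 0 < deg G w
    deg-w = adj⇒0<deg G (≡.trans (Graph.sym G w (P l)) Pl~w)
    w∷P-inj : Injective _≡_ _≡_ (w Vector.∷ P)
    w∷P-inj = ∷-injective P-inj w∉P
    w∷P∩f : ∀ a b → (w Vector.∷ P) a ≢ f b
    w∷P∩f zero    b eq = w∉f (b , ≡.sym eq)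
    w∷P∩f (suc a) b    = P∩f a b

K6-C5-min-degree : ∀ i → 3 ≤ deg K6-C5 i
K6-C5-min-degree = toWitness {a? = Fin.all? (λ i → 3 ≤? deg K6-C5 i)} _

deg≡2⇒∉K6-C5-image : ∀ {n} (G : Graph n) (e : SubgraphOf K6-C5 G) {v} → deg G v ≡ 2 →
                      ∀ b → proj₁ e b ≢ v
deg≡2⇒∉K6-C5-image G (f , f-inj , f-edge) deg≡2 b =
  Embedding.deg<⇒∉image {H = K6-C5} {G = G} f f-inj f-edge b (≡.subst (_< deg K6-C5 b) (≡.sym deg≡2) (K6-C5-min-degree b))

π₇ π₈ : List ℕ
π₇ = piSeq 7 5
π₈ = piSeq 8 5

π₇-not-potentially-K6-C5-graphic : ¬ PotentiallyGraphic K6-C5 π₇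
π₇-not-potentially-K6-C5-graphic (G , realizes , e@(f , f-inj , f-edge))
  with w , w≢6 , 6~w ← neighbour-other-than G (≤-reflexive (≡.sym (realizes 6F))) 6F =
  <-irrefl refl (≡.subst₂ _<_ (cong (λ d → d + 0 + 20) (realizes 6F)) (sum-cong-≗ realizes) bound)
  where
  bound : deg G 6F + 0 + 20 < ∑[ j < 7 ] deg G j
  bound = Embedding.∑deg-outside+∑deg<∑deg {H = K6-C5} {G = G} f f-inj f-edge (6F Vector.∷ Vector.[])
            (λ { {0F} {0F} _ → refl })
            (λ { 0F b → deg≡2⇒∉K6-C5-image G e (realizes 6F) b ∘ ≡.sym })
            {l = 0F} 6~w (λ { 0F → w≢6 ∘ ≡.sym })

π₈-not-potentially-K6-C5-graphic : ¬ PotentiallyGraphic K6-C5 π₈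
π₈-not-potentially-K6-C5-graphic (G , realizes , e@(f , f-inj , f-edge))
  with w , w≢7 , 6~w ← neighbour-other-than G (≤-reflexive (≡.sym (realizes 6F))) 7F =
  <-irrefl refl (≡.subst₂ _<_ (≡.cong₂ (λ d d′ → d + (d′ + 0) + 20) (realizes 6F) (realizes 7F))
                              (sum-cong-≗ realizes) bound)
  where
  w≢6 : w ≢ 6F
  w≢6 refl with ≡.trans (≡.sym 6~w) (Graph.irrefl G 6F)
  ... | ()
  bound : deg G 6F + (deg G 7F + 0) + 20 < ∑[ j < 8 ] deg G j
  bound = Embedding.∑deg-outside+∑deg<∑deg {H = K6-C5} {G = G} f f-inj f-edge (6F Vector.∷ 7F Vector.∷ Vector.[])
            (∷-injective (λ { {0F} {0F} _ → refl }) (λ { 0F () }))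
            (λ { 0F       b → deg≡2⇒∉K6-C5-image G e (realizes 6F) b ∘ ≡.sym
               ; (suc 0F) b → deg≡2⇒∉K6-C5-image G e (realizes 7F) b ∘ ≡.sym })
            {l = 0F} 6~w (λ { 0F → w≢6 ∘ ≡.sym ; (suc 0F) → w≢7 ∘ ≡.sym })

starAndCycle : ℕ → ℕ → ℕ → Bool
starAndCycle n a b =
  ((a ≡ᵇ 0) ∧ (0 <ᵇ b) ∧ (b <ᵇ 6)) ∨ ((0 <ᵇ a) ∧ (b ≡ᵇ suc a) ∧ (b <ᵇ n)) ∨ ((a ≡ᵇ 1) ∧ (suc b ≡ᵇ n))

π₇-graphic : Graphic π₇
π₇-graphic = G , toWitness {a? = Fin.all? λ i → deg G i ≟ℕ lookup π₇ i} _
  where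
  G = symmetricClosure 7 (starAndCycle 7)
        (toWitness {a? = Fin.all? λ i → starAndCycle 7 (toℕ i) (toℕ i) Bool.≟ false} _)

π₈-graphic : Graphic π₈
π₈-graphic = G , toWitness {a? = Fin.all? λ i → deg G i ≟ℕ lookup π₈ i} _
  where
  G = symmetricClosure 8 (starAndCycle 8)
        (toWitness {a? = Fin.all? λ i → starAndCycle 8 (toℕ i) (toℕ i) Bool.≟ false} _)

count : (ℕ → Bool) → ℕ → ℕ
count p m = ∑[ j < m ] indicator (p (toℕ j))

count-false : ∀ m → count (λ _ → false) m ≡ 0
count-false = sum-replicate-zero

count-cong : ∀ {p q} m → (∀ t → p t ≡ q t) → count p m ≡ count q m
count-cong m p≗q = sum-cong-≗ {m} (cong indicator ∘ p≗q ∘ toℕ)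

-- Vertices 0, …, m − 1 of degree two, counting an edge to an outside anchor (the vertex
-- of degree 5 + e) for the e anchored ones.  Adjacency is the symmetric closure of link,
-- so only the values of link below m matter.
record Tail (m e : ℕ) : Set where
  field
    anchored       : ℕ → Bool
    link           : ℕ → ℕ → Bool
    link-irrefl    : ∀ s → link s s ≡ false
    anchored-count : count anchored m ≡ e
    degree-two     : ∀ s → s < m → indicator (anchored s) + count (λ t → link s t ∨ link t s) m ≡ 2

open Tail

emptyTail : Tail 0 0
emptyTail = record
  { anchored = λ _ → false ; link = λ _ _ → false ; link-irrefl = λ _ → refl
  ; anchored-count = refl ; degree-two = λ _ () }

addAnchoredEdge : ∀ {m e} → Tail m e → Tail (2 + m) (2 + e)
addAnchoredEdge {m} T = record
  { anchored = anchored′ ; link = link′ ; link-irrefl = link′-irrefl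
  ; anchored-count = cong (2 +_) (anchored-count T) ; degree-two = degree-two′ }
  where
  anchored′ : ℕ → Bool
  anchored′ (suc (suc s)) = anchored T s
  anchored′ _             = true
  link′ : ℕ → ℕ → Bool
  link′ 0 1                         = true
  link′ (suc (suc s)) (suc (suc t)) = link T s t
  link′ _ _                         = false
  link′-irrefl : ∀ s → link′ s s ≡ false
  link′-irrefl 0             = refl
  link′-irrefl 1             = refl
  link′-irrefl (suc (suc s)) = link-irrefl T s
  degree-two′ : ∀ s → s < 2 + m → indicator (anchored′ s) + count (λ t → link′ s t ∨ link′ t s) (2 + m) ≡ 2
  degree-two′ 0             _               = cong (2 +_) (count-false m)
  degree-two′ 1             _               = cong (2 +_) (count-false m)
  degree-two′ (suc (suc s)) (s≤s (s≤s s<m)) = degree-two T s s<m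

-- The new vertex 0 is put on the edge between the anchor and the old vertex 0.
subdivideAnchorEdge : ∀ {m e} (T : Tail (suc m) e) → anchored T 0 ≡ true → Tail (2 + m) e
subdivideAnchorEdge {m} T 0-anchored = record
  { anchored = anchored′ ; link = link′ ; link-irrefl = link′-irrefl
  ; anchored-count = ≡.trans (cong (λ b → indicator b + count (anchored T ∘ suc) m) (≡.sym 0-anchored))
                             (anchored-count T)
  ; degree-two = degree-two′ }
  where
  anchored′ : ℕ → Bool
  anchored′ 0             = true
  anchored′ 1             = false
  anchored′ (suc (suc s)) = anchored T (suc s)
  link′ : ℕ → ℕ → Bool
  link′ 0 1             = true
  link′ (suc s) (suc t) = link T s t
  link′ _ _             = false
  link′-irrefl : ∀ s → link′ s s ≡ false
  link′-irrefl 0       = refl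
  link′-irrefl (suc s) = link-irrefl T s
  degree-two′ : ∀ s → s < 2 + m → indicator (anchored′ s) + count (λ t → link′ s t ∨ link′ t s) (2 + m) ≡ 2
  degree-two′ 0             _        = cong (2 +_) (count-false m)
  degree-two′ 1             _        =
    ≡.subst (λ b → indicator b + count (λ t → link T 0 t ∨ link T t 0) (suc m) ≡ 2) 0-anchored
            (degree-two T 0 (s≤s z≤n))
  degree-two′ (suc (suc s)) (s≤s s<) = degree-two T (suc s) s<

-- The anchor becomes the new vertex 0, closing the paths through it into cycles.
closeAnchor : ∀ {m} → Tail m 2 → Tail (suc m) 0
closeAnchor {m} T = record
  { anchored = λ _ → false ; link = link′ ; link-irrefl = link′-irrefl
  ; anchored-count = count-false (suc m) ; degree-two = degree-two′ }
  where
  link′ : ℕ → ℕ → Bool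
  link′ 0 (suc t)       = anchored T t
  link′ (suc s) (suc t) = link T s t
  link′ _ _             = false
  link′-irrefl : ∀ s → link′ s s ≡ false
  link′-irrefl 0       = refl
  link′-irrefl (suc s) = link-irrefl T s
  degree-two′ : ∀ s → s < suc m → count (λ t → link′ s t ∨ link′ t s) (suc m) ≡ 2
  degree-two′ 0       _        = ≡.trans (count-cong m (Bool.∨-identityʳ ∘ anchored T)) (anchored-count T)
  degree-two′ (suc s) (s≤s s<) = degree-two T s s<

anchoredPath : ∀ r → Tail (2 + r) 2
anchoredPath-0-anchored : ∀ r → anchored (anchoredPath r) 0 ≡ true

anchoredPath zero    = addAnchoredEdge emptyTail
anchoredPath (suc r) = subdivideAnchorEdge (anchoredPath r) (anchoredPath-0-anchored r)

anchoredPath-0-anchored zero    = refl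
anchoredPath-0-anchored (suc r) = refl

anchoredTail : ∀ k m → k * 2 ≤ m → Tail (2 + m) (2 + k * 2)
anchoredTail zero    m             _                 = anchoredPath m
anchoredTail (suc k) (suc (suc m)) (s≤s (s≤s k*2≤m)) = addAnchoredEdge (anchoredTail k m k*2≤m)

tail-or-exceptional : ∀ k m → k * 2 ≤ m → Tail m (k * 2) ⊎ (k ≡ 0 × (m ≡ 1 ⊎ m ≡ 2))
tail-or-exceptional zero    0                   _                 = inj₁ emptyTail
tail-or-exceptional zero    1                   _                 = inj₂ (refl , inj₁ refl)
tail-or-exceptional zero    2                   _                 = inj₂ (refl , inj₂ refl)
tail-or-exceptional zero    (suc (suc (suc r))) _                 = inj₁ (closeAnchor (anchoredPath r))
tail-or-exceptional (suc k) (suc (suc m))       (s≤s (s≤s k*2≤m)) = inj₁ (anchoredTail k m k*2≤m)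

lookup-replicate′ : ∀ {A : Set} m (x : A) i → lookup (replicate m x) i ≡ x
lookup-replicate′ (suc m) x zero    = refl
lookup-replicate′ (suc m) x (suc i) = lookup-replicate′ m x i

pattern 6+ t = suc (suc (suc (suc (suc (suc t)))))

module Extension {m e} (T : Tail m e) where

  -- Vertex 0 has degree 5 + e; with the pentagram 1 3 5 2 4 on vertices 1, …, 5 it spans
  -- a K6 − C5.  Tail vertex t is vertex 6 + t.
  edge : ℕ → ℕ → Bool
  edge 0 (6+ t)      = anchored T t
  edge 0 (suc _)     = true
  edge 1 3           = true
  edge 1 4           = true
  edge 2 4           = true
  edge 2 5           = true
  edge 3 5           = true
  edge (6+ s) (6+ t) = link T s t
  edge _ _           = false

  edge-irrefl : ∀ a → edge a a ≡ false
  edge-irrefl 0      = refl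
  edge-irrefl 1      = refl
  edge-irrefl 2      = refl
  edge-irrefl 3      = refl
  edge-irrefl 4      = refl
  edge-irrefl 5      = refl
  edge-irrefl (6+ s) = link-irrefl T s

  π : List ℕ
  π = piSeq (6 + m) (5 + e)

  G : Graph (length π)
  G = symmetricClosure (length π) edge (edge-irrefl ∘ toℕ)

  degrees : ∀ i → count (λ b → edge (toℕ i) b ∨ edge b (toℕ i)) (6 + m) ≡ lookup π i
  degrees 0F     = cong (5 +_) (≡.trans (count-cong m (Bool.∨-identityʳ ∘ anchored T)) (anchored-count T))
  degrees 1F     = cong (3 +_) (count-false m)
  degrees 2F     = cong (3 +_) (count-false m)
  degrees 3F     = cong (3 +_) (count-false m)
  degrees 4F     = cong (3 +_) (count-false m)
  degrees 5F     = cong (3 +_) (count-false m)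
  degrees (6+ j) = ≡.trans (degree-two T (toℕ j) (≡.subst (toℕ j <_) (length-replicate m) (Fin.toℕ<n j)))
                           (≡.sym (lookup-replicate′ m 2 j))

  realizes : Realizes π G
  realizes i = begin
    deg G i                                   ≡⟨ deg≡∑adj G i ⟩
    count neighbours (6 + length (replicate m 2)) ≡⟨ cong (λ n → count neighbours (6 + n)) (length-replicate m) ⟩
    count neighbours (6 + m)                  ≡⟨ degrees i ⟩
    lookup π i                                ∎
    where
    open ≡-Reasoning
    neighbours : ℕ → Bool
    neighbours b = edge (toℕ i) b ∨ edge b (toℕ i)

  -- opposite sends the centre 5 of K6 − C5 to 0 and, the pentagram being symmetric under
  -- reflection, the remaining edges onto those of edge.
  embed : Fin 6 → Fin (length π)
  embed i = opposite i ↑ˡ length (replicate m 2)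

  embed-injective : Injective _≡_ _≡_ embed
  embed-injective {i} {j} eq = begin
    i                       ≡⟨ Fin.opposite-involutive i ⟨
    opposite (opposite i)   ≡⟨ cong opposite (Fin.↑ˡ-injective _ (opposite i) (opposite j) eq) ⟩
    opposite (opposite j)   ≡⟨ Fin.opposite-involutive j ⟩
    j                       ∎
    where open ≡-Reasoning

  embed-edges : ∀ i j → adj K6-C5 i j ≡ true → adj G (embed i) (embed j) ≡ true
  embed-edges = toWitness {a? = Fin.all? λ i → Fin.all? λ j →
                  (adj K6-C5 i j Bool.≟ true) →-dec (adj G (embed i) (embed j) Bool.≟ true)} _

  potentially-K6-C5-graphic : PotentiallyGraphic K6-C5 π
  potentially-K6-C5-graphic = G , realizes , embed , embed-injective , embed-edges

sum-replicate′ : ∀ m x → sum (replicate m x) ≡ m * x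
sum-replicate′ zero    x = refl
sum-replicate′ (suc m) x = cong (x +_) (sum-replicate′ m x)

2∣sum-piSeq⇒2∣e : ∀ m e → 2 ∣ sum (piSeq (6 + m) (5 + e)) → 2 ∣ e
2∣sum-piSeq⇒2∣e m e 2∣sum = ∣m+n∣m⇒∣n (≡.subst (2 ∣_) sum≡ 2∣sum) (n∣m*n (10 + m))
  where
  rearrange : ∀ m e → 5 + e + (15 + m * 2) ≡ (10 + m) * 2 + e
  rearrange = solve-∀
  sum≡ : sum (piSeq (6 + m) (5 + e)) ≡ (10 + m) * 2 + e
  sum≡ = ≡.trans (cong (λ s → 5 + e + (15 + s)) (sum-replicate′ m 2)) (rearrange m e)

potentially⇒graphic : ∀ {k} {H : Graph k} {π} → PotentiallyGraphic H π → Graphic π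
potentially⇒graphic (G , realizes , _) = G , realizes

potentially-K6-C5-graphic-or-exceptional : ∀ m e → e ≤ m → 2 ∣ e →
  PotentiallyGraphic K6-C5 (piSeq (6 + m) (5 + e)) ⊎ (piSeq (6 + m) (5 + e) ≡ π₇ ⊎ piSeq (6 + m) (5 + e) ≡ π₈)
potentially-K6-C5-graphic-or-exceptional m .(k * 2) e≤m (divides k refl) with tail-or-exceptional k m e≤m
... | inj₁ T                  = inj₁ (Extension.potentially-K6-C5-graphic T)
... | inj₂ (refl , inj₁ refl) = inj₂ (inj₁ refl)
... | inj₂ (refl , inj₂ refl) = inj₂ (inj₂ refl)

lemma2p11 : (n d₁ : ℕ) → 6 ≤ n → 5 ≤ d₁ → d₁ ≤ n ∸ 1 → 2 ∣ sum (piSeq n d₁) →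
    Graphic (piSeq n d₁) ×
    (PotentiallyGraphic K6-C5 (piSeq n d₁) ⇔
      (piSeq n d₁ ≢ 5 ∷ 3 ∷ 3 ∷ 3 ∷ 3 ∷ 3 ∷ 2 ∷ [] ×
       piSeq n d₁ ≢ 5 ∷ 3 ∷ 3 ∷ 3 ∷ 3 ∷ 3 ∷ 2 ∷ 2 ∷ []))
lemma2p11 n d₁ 6≤n 5≤d₁ d₁≤n∸1 2∣sum with m≤n⇒∃[o]m+o≡n 6≤n | m≤n⇒∃[o]m+o≡n 5≤d₁
... | m , refl | e , refl = graphic , mk⇔ not-exceptional potentially
  where
  cases : PotentiallyGraphic K6-C5 (piSeq (6 + m) (5 + e)) ⊎ (piSeq (6 + m) (5 + e) ≡ π₇ ⊎ piSeq (6 + m) (5 + e) ≡ π₈)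
  cases = potentially-K6-C5-graphic-or-exceptional m e (+-cancelˡ-≤ 5 e m d₁≤n∸1) (2∣sum-piSeq⇒2∣e m e 2∣sum)
  graphic : Graphic (piSeq (6 + m) (5 + e))
  graphic = [ potentially⇒graphic {H = K6-C5} , [ (λ eq → ≡.subst Graphic (≡.sym eq) π₇-graphic)
                                               , (λ eq → ≡.subst Graphic (≡.sym eq) π₈-graphic) ] ] cases
  not-exceptional : PotentiallyGraphic K6-C5 (piSeq (6 + m) (5 + e)) →
                    piSeq (6 + m) (5 + e) ≢ π₇ × piSeq (6 + m) (5 + e) ≢ π₈
  not-exceptional pg = (λ eq → π₇-not-potentially-K6-C5-graphic (≡.subst (PotentiallyGraphic K6-C5) eq pg))
                     , (λ eq → π₈-not-potentially-K6-C5-graphic (≡.subst (PotentiallyGraphic K6-C5) eq pg))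
  potentially : piSeq (6 + m) (5 + e) ≢ π₇ × piSeq (6 + m) (5 + e) ≢ π₈ →
                PotentiallyGraphic K6-C5 (piSeq (6 + m) (5 + e))
  potentially (≢π₇ , ≢π₈) = [ id , [ ⊥-elim ∘ ≢π₇ , ⊥-elim ∘ ≢π₈ ] ] cases
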